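{- Let $S=\{s_1,\dots,s_t\}$ with $t\ge 3$, $1<s_1<s_2<\dots<s_t$ integers and $\gcd(s_1,\dots,s_t)=1$, and let $\mathbb{S}=\langle S\rangle$ with Frobenius number $F(\mathbb{S})$. If there exists $k\in\mathbb{S}$ with $\mathrm{MinCost}_S(k)<\mathrm{GreedyCost}_S(k)$, then the smallest such $k$ satisfies $$s_3+s_1+2\le k\le F(\mathbb{S})+s_t+s_{t-1}.$$ Moreover, both bounds are tight: there exist such sets $S$ for which the smallest such $k$ equals $s_3+s_1+2$, and there exist such sets $S$ for which the smallest such $k$ equals $F(\mathbb{S})+s_t+s_{t-1}$.
   Context: $\langle S\rangle=\{\sum_i a_i s_i : a_i\in\mathbb{N}_0\}$ is the numerical semigroup generated by $S$; $F(\mathbb{S})$ is the largest integer not in $\mathbb{S}$. A representation of $k\in\langle S\rangle$ is a vector $(a_1,\dots,a_t)\in\mathbb{N}_0^t$ with $\sum_i a_i s_i=k$; its cost is $\sum_i a_i$. $\mathrm{MinCost}_S(k)$ is the minimum cost over all representations of $k$. The (generalized) greedy representation of $k\in\langle S\rangle$, $k>0$, is computed as follows: set $r:=k$; for $i=t,t-1,\dots,1$ let $a_i$ be the largest integer $q\ge 0$ such that $r-q s_i\in\langle S\rangle$, and replace $r$ by $r-a_i s_i$ (at the end $r=0$). $\mathrm{GreedyCost}_S(k)=\sum_i a_i$ for this vector. -}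

module Defs where

open import Data.Nat using (ℕ; zero; suc; _+_; _*_; _∸_; _≤_; _<_)
open import Data.Nat.GCD using (gcd)
open import Data.Fin as Fin using (Fin; fromℕ; inject₁)
open import Data.Vec using (Vec; []; _∷_; lookup; zipWith; sum; foldr; reverse)
open import Data.Product using (Σ; ∃; _×_)
open import Relation.Nullary using (¬_)
open import Relation.Binary.PropositionalEquality using (_≡_)

-- The generators s_1,…,s_t are given as a vector  s : Vec ℕ t,
-- with s_i = lookup s (i-1).

IsRep : ∀ {t} → Vec ℕ t → ℕ → Vec ℕ t → Set
IsRep s k a = sum (zipWith _*_ a s) ≡ k

cost : ∀ {t} → Vec ℕ t → ℕ
cost a = sum a

InSG : ∀ {t} → Vec ℕ t → ℕ → Set
InSG {t} s k = Σ (Vec ℕ t) (λ a → IsRep s k a)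

IsMinCost : ∀ {t} → Vec ℕ t → ℕ → ℕ → Set
IsMinCost {t} s k c =
  Σ (Vec ℕ t) (λ a → IsRep s k a × cost a ≡ c)
  × (∀ (a : Vec ℕ t) → IsRep s k a → c ≤ cost a)

-- The greedy procedure, run over a list of generators in the order it
-- processes them (s_t first), with current remainder r, producing the
-- coefficients in the same order.  G is membership in ⟨S⟩.
-- At each generator s, the coefficient q is the largest q ≥ 0 such that
-- r - q s ∈ ⟨S⟩ (with q s ≤ r, so the subtraction is genuine).
data GreedyRun (G : ℕ → Set) : ∀ {n} → Vec ℕ n → ℕ → Vec ℕ n → Set where
  done : ∀ r → GreedyRun G [] r []
  step : ∀ {n} {gs : Vec ℕ n} {as : Vec ℕ n} {g r q : ℕ} →
         q * g ≤ r →
         G (r ∸ q * g) →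
         (∀ q' → q < q' → q' * g ≤ r → ¬ G (r ∸ q' * g)) →
         GreedyRun G gs (r ∸ q * g) as →
         GreedyRun G (g ∷ gs) r (q ∷ as)

IsGreedyRep : ∀ {t} → Vec ℕ t → ℕ → Vec ℕ t → Set
IsGreedyRep s k a = GreedyRun (InSG s) (reverse s) k (reverse a)

IsGreedyCost : ∀ {t} → Vec ℕ t → ℕ → ℕ → Set
IsGreedyCost {t} s k c = Σ (Vec ℕ t) (λ a → IsGreedyRep s k a × cost a ≡ c)

GreedyFails : ∀ {t} → Vec ℕ t → ℕ → Set
GreedyFails s k =
  InSG s k × 0 < k ×
  ∃ λ m → ∃ λ g → IsMinCost s k m × IsGreedyCost s k g × m < g

IsLeastGreedyFailure : ∀ {t} → Vec ℕ t → ℕ → Set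
IsLeastGreedyFailure s k = GreedyFails s k × (∀ k' → k' < k → ¬ GreedyFails s k')

IsFrobenius : ∀ {t} → Vec ℕ t → ℕ → Set
IsFrobenius s F = ¬ InSG s F × (∀ n → F < n → InSG s n)

ValidGens : ∀ {t} → Vec ℕ t → Set
ValidGens {t} s =
  (∀ (i : Fin t) → 1 < lookup s i)
  × (∀ (i j : Fin t) → i Fin.< j → lookup s i < lookup s j)
  × foldr (λ _ → ℕ) gcd 0 s ≡ 1

s₁ s₃ sₜ sₜ₋₁ : ∀ {n} → Vec ℕ (suc (suc (suc n))) → ℕ
s₁ s = lookup s Fin.zero
s₃ s = lookup s (Fin.suc (Fin.suc Fin.zero))
sₜ {n} s = lookup s (fromℕ (suc (suc n)))
sₜ₋₁ {n} s = lookup s (inject₁ (fromℕ (suc n)))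

-- Let k be the least element on which greedy fails, a₀ a representation of k cheaper than greedy,
-- and L the first generator greedy takes at k. Greedy is optimal at k − L < k and costs one less
-- there than at k, so no representation of k − L is cheaper than a₀. Hence a₀ cannot contain L,
-- nor any larger generator g (greedy would have taken g). If L < s₃, a₀ consists of copies of s₁
-- and k ≤ |a₀| s₁ ≤ k − L, which is absurd; so L ≥ s₃, |a₀| ≥ 2 and k = L + (k − L) ≥ s₃ + 2 s₁.
--
-- Above F + sₜ greedy starts with sₜ. If k > F + sₜ + sₜ₋₁, split a generator g off a₀. For g = sₜ
-- the rest represents k − sₜ more cheaply than a₀. Otherwise g ≤ sₜ₋₁, so x = k − g > F + sₜ and
-- greedy is optimal at x; trading its first sₜ for g again represents k − sₜ more cheaply than a₀.
--
-- Both bounds are attained with F = 3: for S = {2, 5, 6} greedy writes 10 = 6 + 2 + 2 instead of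
-- 5 + 5, and for S = {2, 5, 7} it writes 15 = 7 + 2 + 2 + 2 + 2 instead of 5 + 5 + 5; that these are
-- the least failures is decided by computation.

module Submission where

open import Defs
open import Data.Empty using (⊥-elim)
open import Data.Fin as Fin using (Fin; toℕ)
open import Data.Fin.Properties as Finₚ using (≤fromℕ; toℕ-inject₁; all?)
open import Data.Nat
  using (ℕ; zero; suc; pred; _+_; _*_; _∸_; _≤_; _<_; _>_; z≤n; s≤s; s≤s⁻¹; _≤?_; _<?_; >-nonZero)
open import Data.Nat.GCD using (gcd)
open import Data.Nat.Induction using (<-rec)
open import Data.Nat.Properties
open import Data.Nat.Tactic.RingSolver using (solve-∀)
open import Data.Product using (Σ; ∃; _×_; _,_; proj₁; proj₂)
open import Data.Sum using (inj₁; inj₂)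
open import Data.Unit using (tt)
open import Data.Vec using (Vec; []; _∷_; lookup; zipWith; sum; foldr; reverse; _∷ʳ_)
open import Data.Vec.Membership.Propositional using (_∈_)
open import Data.Vec.Membership.Propositional.Properties using (∈-lookup)
open import Data.Vec.Properties using (reverse-∷; reverse-involutive)
open import Data.Vec.Relation.Unary.All as All using (All; []; _∷_)
open import Data.Vec.Relation.Unary.All.Properties using (lookup⁻)
open import Data.Vec.Relation.Unary.AllPairs using (AllPairs; []; _∷_)
open import Data.Vec.Relation.Unary.Any as Any using (here; there)
open import Data.Vec.Relation.Unary.Any.Properties using (lookup-index)
open import Function using (flip; _∘_; case_of_)
open import Level using (0ℓ)
open import Relation.Binary.Core using (Rel)
open import Relation.Binary.Definitions using (tri<; tri≈; tri>)
open import Relation.Binary.PropositionalEquality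
open import Relation.Nullary using (¬_; ¬?; Dec; yes; no)
open import Relation.Nullary.Decidable using (_×-dec_; _→-dec_; map′; toWitness; toWitnessFalse)
open import Relation.Unary using (Pred; Decidable)

private
  variable
    n t : ℕ
    A : Set

pred<self : ∀ {m} → 0 < m → pred m < m
pred<self (s≤s _) = ≤-refl

m∸n∸o+n≡m∸o : ∀ {m n o} → n ≤ m → o ≤ m ∸ n → m ∸ n ∸ o + n ≡ m ∸ o
m∸n∸o+n≡m∸o {m} {n} {o} n≤m o≤m∸n = begin
  m ∸ n ∸ o + n    ≡⟨ cong (_+ n) (∸-+-assoc m n o) ⟩
  m ∸ (n + o) + n  ≡⟨ cong (λ z → m ∸ z + n) (+-comm n o) ⟩
  m ∸ (o + n) + n  ≡⟨ cong (_+ n) (∸-+-assoc m o n) ⟨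
  m ∸ o ∸ n + n    ≡⟨ m∸n+n≡m n≤m∸o ⟩
  m ∸ o            ∎
  where
  open ≡-Reasoning
  n≤m∸o : n ≤ m ∸ o
  n≤m∸o = m+n≤o⇒m≤o∸n n (subst (_≤ m) (+-comm o n) (m≤o∸n⇒m+n≤o o n≤m o≤m∸n))

∈⇒lookup : ∀ {x} {xs : Vec A n} → x ∈ xs → ∃ λ i → lookup xs i ≡ x
∈⇒lookup x∈xs = Any.index x∈xs , sym (lookup-index x∈xs)

All-∷ʳ : ∀ {P : Pred A 0ℓ} {x} {xs : Vec A n} → All P xs → P x → All P (xs ∷ʳ x)
All-∷ʳ []         px = px ∷ []
All-∷ʳ (py ∷ pxs) px = py ∷ All-∷ʳ pxs px

All-reverse : ∀ {P : Pred A 0ℓ} {xs : Vec A n} → All P xs → All P (reverse xs)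
All-reverse {P = P} {xs = []}     []         = []
All-reverse {P = P} {xs = x ∷ xs} (px ∷ pxs) =
  subst (All P) (sym (reverse-∷ x xs)) (All-∷ʳ (All-reverse pxs) px)

AllPairs-∷ʳ : ∀ {R : Rel A 0ℓ} {x} {xs : Vec A n} →
              AllPairs R xs → All (flip R x) xs → AllPairs R (xs ∷ʳ x)
AllPairs-∷ʳ []         []       = [] ∷ []
AllPairs-∷ʳ (ry ∷ rxs) (r ∷ rs) = All-∷ʳ ry r ∷ AllPairs-∷ʳ rxs rs

AllPairs-reverse : ∀ {R : Rel A 0ℓ} {xs : Vec A n} → AllPairs R xs → AllPairs (flip R) (reverse xs)
AllPairs-reverse {R = R} {xs = []}     []         = []
AllPairs-reverse {R = R} {xs = x ∷ xs} (rx ∷ rxs) =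
  subst (AllPairs (flip R)) (sym (reverse-∷ x xs))
    (AllPairs-∷ʳ (AllPairs-reverse rxs) (All-reverse rx))

∈-reverse⁻ : ∀ {x} {xs : Vec A n} → x ∈ reverse xs → x ∈ xs
∈-reverse⁻ {xs = xs} =
  All.lookup (All-reverse {P = _∈ xs} (lookup⁻ {xs = xs} (λ i → ∈-lookup i xs)))

∈-reverse⁺ : ∀ {x} {xs : Vec A n} → x ∈ xs → x ∈ reverse xs
∈-reverse⁺ {xs = xs} x∈xs = ∈-reverse⁻ (subst (_ ∈_) (sym (reverse-involutive xs)) x∈xs)

sum-∷ʳ : ∀ (xs : Vec ℕ n) x → sum (xs ∷ʳ x) ≡ sum xs + x
sum-∷ʳ []       x = +-identityʳ x
sum-∷ʳ (y ∷ xs) x = trans (cong (y +_) (sum-∷ʳ xs x)) (sym (+-assoc y (sum xs) x))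

sum-reverse : ∀ (xs : Vec ℕ n) → sum (reverse xs) ≡ sum xs
sum-reverse []       = refl
sum-reverse (x ∷ xs) = begin
  sum (reverse (x ∷ xs)) ≡⟨ cong sum (reverse-∷ x xs) ⟩
  sum (reverse xs ∷ʳ x)  ≡⟨ sum-∷ʳ (reverse xs) x ⟩
  sum (reverse xs) + x   ≡⟨ cong (_+ x) (sum-reverse xs) ⟩
  sum xs + x             ≡⟨ +-comm (sum xs) x ⟩
  x + sum xs             ∎
  where open ≡-Reasoning

zipWith-∷ʳ : ∀ (f : A → A → A) (xs ys : Vec A n) x y →
             zipWith f (xs ∷ʳ x) (ys ∷ʳ y) ≡ zipWith f xs ys ∷ʳ f x y
zipWith-∷ʳ f []       []       x y = refl
zipWith-∷ʳ f (u ∷ xs) (v ∷ ys) x y = cong (f u v ∷_) (zipWith-∷ʳ f xs ys x y)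

zipWith-reverse : ∀ (f : A → A → A) (xs ys : Vec A n) →
                  zipWith f (reverse xs) (reverse ys) ≡ reverse (zipWith f xs ys)
zipWith-reverse f []       []       = refl
zipWith-reverse f (x ∷ xs) (y ∷ ys) = begin
  zipWith f (reverse (x ∷ xs)) (reverse (y ∷ ys))
    ≡⟨ cong₂ (zipWith f) (reverse-∷ x xs) (reverse-∷ y ys) ⟩
  zipWith f (reverse xs ∷ʳ x) (reverse ys ∷ʳ y)
    ≡⟨ zipWith-∷ʳ f (reverse xs) (reverse ys) x y ⟩
  zipWith f (reverse xs) (reverse ys) ∷ʳ f x y
    ≡⟨ cong (_∷ʳ f x y) (zipWith-reverse f xs ys) ⟩
  reverse (zipWith f xs ys) ∷ʳ f x y
    ≡⟨ reverse-∷ (f x y) (zipWith f xs ys) ⟨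
  reverse (zipWith f (x ∷ xs) (y ∷ ys)) ∎
  where open ≡-Reasoning

-- IsRep s k a unfolds to  a · s ≡ k.
infix 7 _·_
_·_ : Vec ℕ n → Vec ℕ n → ℕ
a · s = sum (zipWith _*_ a s)

·-reverse : ∀ (a s : Vec ℕ n) → reverse a · s ≡ a · reverse s
·-reverse a s = begin
  reverse a · s                              ≡⟨ cong (reverse a ·_) (reverse-involutive s) ⟨
  reverse a · reverse (reverse s)            ≡⟨ cong sum (zipWith-reverse _*_ a (reverse s)) ⟩
  sum (reverse (zipWith _*_ a (reverse s)))  ≡⟨ sum-reverse (zipWith _*_ a (reverse s)) ⟩
  a · reverse s                              ∎
  where open ≡-Reasoning

adjoin : ∀ {g} {s : Vec ℕ n} → g ∈ s → (a : Vec ℕ n) →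
         ∃ λ b → b · s ≡ a · s + g × sum b ≡ suc (sum a)
adjoin {s = x ∷ s} (here refl) (q ∷ a) = suc q ∷ a , rearrange x (q * x) (a · s) , refl
  where
  rearrange : ∀ x y z → x + y + z ≡ y + z + x
  rearrange = solve-∀
adjoin {g = g} {s = x ∷ s} (there g∈s) (q ∷ a) =
  let b , b·s , cost-b = adjoin g∈s a in
  q ∷ b , trans (cong (q * x +_) b·s) (sym (+-assoc (q * x) (a · s) g)) ,
          trans (cong (q +_) cost-b) (+-suc q (sum a))

record Splits (s a : Vec ℕ n) (g : ℕ) : Set where
  constructor split
  field
    remainder      : Vec ℕ n
    remainder+g    : remainder · s + g ≡ a · s
    remainder-cost : suc (sum remainder) ≡ sum a

  remainder-value : remainder · s ≡ a · s ∸ g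
  remainder-value = trans (sym (m+n∸n≡m (remainder · s) g)) (cong (_∸ g) remainder+g)

  g≤value : g ≤ a · s
  g≤value = subst (g ≤_) remainder+g (m≤n+m g (remainder · s))

splits-head : ∀ x q (s a : Vec ℕ n) → Splits (x ∷ s) (suc q ∷ a) x
splits-head x q s a = split (q ∷ a) (rearrange x (q * x) (a · s)) refl
  where
  rearrange : ∀ x y z → y + z + x ≡ x + y + z
  rearrange = solve-∀

splits-of-positive : ∀ (s a : Vec ℕ n) → 0 < a · s → ∃ λ g → g ∈ s × Splits s a g
splits-of-positive []      []          ()
splits-of-positive (x ∷ s) (suc q ∷ a) _     = x , here refl , splits-head x q s a
splits-of-positive (x ∷ s) (zero ∷ a)  a·s>0 =
  let g , g∈s , split b b·s+g cost-b = splits-of-positive s a a·s>0 in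
  g , there g∈s , split (zero ∷ b) b·s+g cost-b

cost-positive : ∀ (s a : Vec ℕ n) → 0 < a · s → 0 < sum a
cost-positive s a a·s>0 =
  let _ , _ , split _ _ cost = splits-of-positive s a a·s>0 in subst (0 <_) cost (s≤s z≤n)

cost*min≤value : ∀ {c} (s a : Vec ℕ n) → (∀ {g} → g ∈ s → c ≤ g) → sum a * c ≤ a · s
cost*min≤value         []      []      _  = z≤n
cost*min≤value {c = c} (x ∷ s) (q ∷ a) c≤ = begin
  (q + sum a) * c    ≡⟨ *-distribʳ-+ c q (sum a) ⟩
  q * c + sum a * c  ≤⟨ +-mono-≤ (*-monoʳ-≤ q (c≤ (here refl)))
                               (cost*min≤value s a (c≤ ∘ there)) ⟩
  q * x + a · s      ∎
  where open ≤-Reasoning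

cost≤value : ∀ (s a : Vec ℕ n) → (∀ {g} → g ∈ s → 0 < g) → sum a ≤ a · s
cost≤value s a pos = subst (_≤ a · s) (*-identityʳ (sum a)) (cost*min≤value s a pos)

value≤cost*max : ∀ {c} (s a : Vec ℕ n) → (∀ {g} → g ∈ s → Splits s a g → g ≤ c) →
                 a · s ≤ sum a * c
value≤cost*max         []      []          _  = z≤n
value≤cost*max         (x ∷ s) (zero ∷ a)  ≤c =
  value≤cost*max s a λ g∈s (split b b·s+g cost-b) →
    ≤c (there g∈s) (split (zero ∷ b) b·s+g cost-b)
value≤cost*max {c = c} (x ∷ s) (suc q ∷ a) ≤c = begin
  suc q * x + a · s      ≤⟨ +-mono-≤ (*-monoʳ-≤ (suc q) (≤c (here refl) (splits-head x q s a)))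
                                     (value≤cost*max s a ≤c′) ⟩
  suc q * c + sum a * c  ≡⟨ *-distribʳ-+ c (suc q) (sum a) ⟨
  (suc q + sum a) * c    ∎
  where
  open ≤-Reasoning
  ≤c′ : ∀ {g} → g ∈ s → Splits s a g → g ≤ c
  ≤c′ {g} g∈s (split b b·s+g cost-b) = ≤c (there g∈s) (split (suc q ∷ b)
    (trans (+-assoc (suc q * x) (b · s) g) (cong (suc q * x +_) b·s+g))
    (trans (sym (+-suc (suc q) (sum b))) (cong (suc q +_) cost-b)))

AddClosed : (ℕ → Set) → Vec ℕ n → Set
AddClosed G gs = ∀ {x g} → g ∈ gs → G x → G (x + g)

module _ {G : ℕ → Set} where

  AddClosed-* : ∀ {gs : Vec ℕ n} {g x} → AddClosed G gs → g ∈ gs →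
                ∀ q → G x → G (x + q * g)
  AddClosed-* {x = x} _  _   zero    Gx = subst G (sym (+-identityʳ x)) Gx
  AddClosed-* {g = g} {x} cl g∈gs (suc q) Gx =
    subst G (trans (+-assoc x (q * g) g) (cong (x +_) (+-comm (q * g) g)))
      (cl g∈gs (AddClosed-* cl g∈gs q Gx))

  AddClosed-· : ∀ {gs : Vec ℕ n} {x} → AddClosed G gs → ∀ as → G x → G (x + as · gs)
  AddClosed-· {gs = []}     {x} _  []       Gx = subst G (sym (+-identityʳ x)) Gx
  AddClosed-· {gs = g ∷ gs} {x} cl (q ∷ as) Gx =
    subst G (+-assoc x (q * g) (as · gs))
      (AddClosed-· (cl ∘ there) as (AddClosed-* cl (here refl) q Gx))

  leftover : ∀ {gs as : Vec ℕ n} {r} → GreedyRun G gs r as → ℕ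
  leftover (done r)         = r
  leftover (step _ _ _ run) = leftover run

  ·+leftover : ∀ {gs as : Vec ℕ n} {r} (run : GreedyRun G gs r as) → as · gs + leftover run ≡ r
  ·+leftover (done r) = refl
  ·+leftover {gs = g ∷ gs} {q ∷ as} {r} (step qg≤r _ _ run) = begin
    q * g + as · gs + leftover run    ≡⟨ +-assoc (q * g) (as · gs) (leftover run) ⟩
    q * g + (as · gs + leftover run)  ≡⟨ cong (q * g +_) (·+leftover run) ⟩
    q * g + (r ∸ q * g)               ≡⟨ m+[n∸m]≡n qg≤r ⟩
    r                                 ∎
    where open ≡-Reasoning

  leftover-∈ : ∀ {gs as : Vec ℕ n} {r} → G r → (run : GreedyRun G gs r as) → G (leftover run)
  leftover-∈ Gr (done _)           = Gr
  leftover-∈ _  (step _ Gr′ _ run) = leftover-∈ Gr′ run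

  -- Otherwise adding back the later coefficients shows that g could have been taken once more.
  leftover-stuck : ∀ {gs as : Vec ℕ n} {r g} → AddClosed G gs → (run : GreedyRun G gs r as) →
                   g ∈ gs → g ≤ leftover run → ¬ G (leftover run ∸ g)
  leftover-stuck {gs = g ∷ gs} {q ∷ as} {r} cl (step qg≤r _ maximal run) (here refl)
                 g≤lo G[lo∸g] =
    maximal (suc q) ≤-refl (m≤o∸n⇒m+n≤o g qg≤r g≤r∸qg)
      (subst G remainder (AddClosed-· (cl ∘ there) as G[lo∸g]))
    where
    lo : ℕ
    lo = leftover run
    g≤r∸qg : g ≤ r ∸ q * g
    g≤r∸qg = ≤-trans g≤lo (subst (lo ≤_) (·+leftover run) (m≤n+m lo (as · gs)))
    remainder : lo ∸ g + as · gs ≡ r ∸ (g + q * g)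
    remainder = begin
      lo ∸ g + as · gs        ≡⟨ +-comm (lo ∸ g) (as · gs) ⟩
      as · gs + (lo ∸ g)      ≡⟨ +-∸-assoc (as · gs) g≤lo ⟨
      as · gs + lo ∸ g        ≡⟨ cong (_∸ g) (·+leftover run) ⟩
      r ∸ q * g ∸ g           ≡⟨ ∸-+-assoc r (q * g) g ⟩
      r ∸ (q * g + g)         ≡⟨ cong (r ∸_) (+-comm (q * g) g) ⟩
      r ∸ (g + q * g)         ∎
      where open ≡-Reasoning
  leftover-stuck cl (step _ _ _ run) (there g∈gs) = leftover-stuck (cl ∘ there) run g∈gs

  GreedyRun-functional : ∀ {gs as bs : Vec ℕ n} {r} →
                         GreedyRun G gs r as → GreedyRun G gs r bs → as ≡ bs
  GreedyRun-functional (done _) (done _) = refl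
  GreedyRun-functional (step {q = q} qg≤r Gr maximal run)
                       (step {q = q′} q′g≤r Gr′ maximal′ run′)
    with <-cmp q q′
  ... | tri< q<q′ _ _  = ⊥-elim (maximal q′ q<q′ q′g≤r Gr′)
  ... | tri≈ _ refl _  = cong (q ∷_) (GreedyRun-functional run run′)
  ... | tri> _ _ q′<q  = ⊥-elim (maximal′ q q′<q qg≤r Gr)

greatest≤ : {P : ℕ → Set} → Decidable P → P 0 → ∀ B →
            ∃ λ q → q ≤ B × P q × (∀ q′ → q < q′ → q′ ≤ B → ¬ P q′)
greatest≤ P? P0 zero = zero , z≤n , P0 , λ q′ 0<q′ q′≤0 _ → <⇒≱ 0<q′ q′≤0
greatest≤ P? P0 (suc B) with P? (suc B)
... | yes PB = suc B , ≤-refl , PB , λ q′ B<q′ q′≤B _ → <⇒≱ B<q′ q′≤B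
... | no ¬PB =
  let q , q≤B , Pq , maximal = greatest≤ P? P0 B in
  q , m≤n⇒m≤1+n q≤B , Pq , λ q′ q<q′ q′≤1+B → case m≤n⇒m<n∨m≡n q′≤1+B of λ where
    (inj₁ q′≤B)  → maximal q′ q<q′ (s≤s⁻¹ q′≤B)
    (inj₂ refl) → ¬PB

greedyRun-exists : {G : ℕ → Set} → Decidable G → (gs : Vec ℕ n) → (∀ {g} → g ∈ gs → 0 < g) →
            ∀ {r} → G r → ∃ (GreedyRun G gs r)
greedyRun-exists G? []       _   {r} _  = [] , done r
greedyRun-exists G? (g ∷ gs) pos {r} Gr =
  let q , _ , (qg≤r , G[r∸qg]) , maximal =
        greatest≤ (λ q → q * g ≤? r ×-dec G? (r ∸ q * g)) (z≤n , Gr) r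
      as , run = greedyRun-exists G? gs (pos ∘ there) G[r∸qg]
  in q ∷ as ,
     step qg≤r G[r∸qg] (λ q′ q<q′ q′g≤r G′ → maximal q′ q<q′ (q′≤r q′g≤r) (q′g≤r , G′)) run
  where
  q′≤r : ∀ {q′} → q′ * g ≤ r → q′ ≤ r
  q′≤r {q′} q′g≤r = ≤-trans (m≤m*n q′ g {{>-nonZero (pos (here refl))}}) q′g≤r

record FirstPick (G : ℕ → Set) (gs : Vec ℕ n) (r : ℕ) (as : Vec ℕ n) : Set where
  field
    pick      : ℕ
    pick∈     : pick ∈ gs
    pick≤     : pick ≤ r
    G-after   : G (r ∸ pick)
    rest      : Vec ℕ n
    rest-run  : GreedyRun G gs (r ∸ pick) rest
    rest-cost : suc (sum rest) ≡ sum as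
    skipped   : ∀ {g} → g ∈ gs → pick < g → g ≤ r → ¬ G (r ∸ g)

firstPick : ∀ {G : ℕ → Set} {gs as : Vec ℕ n} {r} → AddClosed G gs → AllPairs _>_ gs →
            GreedyRun G gs r as → 0 < sum as → FirstPick G gs r as
firstPick {G = G} {g ∷ gs} {zero ∷ as} {r} cl (_ ∷ desc) (step _ _ maximal run) cost>0 = record
  { pick      = pick
  ; pick∈     = there pick∈
  ; pick≤     = pick≤
  ; G-after   = G-after
  ; rest      = zero ∷ rest
  ; rest-run  = step z≤n G-after maximal′ rest-run
  ; rest-cost = rest-cost
  ; skipped   = λ where
      (here refl) pick<g g≤r G[r∸g] →
        maximal 1 ≤-refl (subst (_≤ r) (sym (*-identityˡ g)) g≤r)
          (subst G (cong (r ∸_) (sym (*-identityˡ g))) G[r∸g])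
      (there g∈gs) → skipped g∈gs
  }
  where
  open FirstPick (firstPick (cl ∘ there) desc run cost>0)
  maximal′ : ∀ q′ → 0 < q′ → q′ * g ≤ r ∸ pick → ¬ G (r ∸ pick ∸ q′ * g)
  maximal′ q′ q′>0 q′g≤ G′ =
    maximal q′ q′>0 (≤-trans q′g≤ (m∸n≤m r pick))
      (subst G (m∸n∸o+n≡m∸o pick≤ q′g≤) (cl (there pick∈) G′))
firstPick {G = G} {g ∷ gs} {suc q ∷ as} {r} cl (g>gs ∷ _) (step [g+qg]≤r G′ maximal run) _ =
  record
  { pick      = g
  ; pick∈     = here refl
  ; pick≤     = ≤-trans (m≤m+n g (q * g)) [g+qg]≤r
  ; G-after   = subst G restore (AddClosed-* {G = G} {g = g} cl (here refl) q G′)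
  ; rest      = q ∷ as
  ; rest-run  = step qg≤r∸g (subst G (sym (∸-+-assoc r g (q * g))) G′) maximal′
                  (subst (λ z → GreedyRun G gs z as) (sym (∸-+-assoc r g (q * g))) run)
  ; rest-cost = refl
  ; skipped   = λ where
      (here refl) g<g → ⊥-elim (<-irrefl refl g<g)
      (there g′∈gs) g<g′ → ⊥-elim (<-asym g<g′ (All.lookup g>gs g′∈gs))
  }
  where
  qg≤r∸g : q * g ≤ r ∸ g
  qg≤r∸g = m+n≤o⇒m≤o∸n (q * g) (subst (_≤ r) (+-comm g (q * g)) [g+qg]≤r)
  restore : r ∸ (g + q * g) + q * g ≡ r ∸ g
  restore = trans (cong (_+ q * g) (sym (∸-+-assoc r g (q * g)))) (m∸n+n≡m qg≤r∸g)
  maximal′ : ∀ q′ → q < q′ → q′ * g ≤ r ∸ g → ¬ G (r ∸ g ∸ q′ * g)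
  maximal′ q′ q<q′ q′g≤ G″ =
    maximal (suc q′) (s≤s q<q′)
      (subst (_≤ r) (+-comm (q′ * g) g)
        (m≤o∸n⇒m+n≤o (q′ * g) (≤-trans (m≤m+n g (q * g)) [g+qg]≤r) q′g≤))
      (subst G (∸-+-assoc r g (q′ * g)) G″)

RepWithin : Vec ℕ n → ℕ → ℕ → Set
RepWithin s x c = ∃ λ a → a · s ≡ x × sum a ≤ c

repWithin? : ∀ (s : Vec ℕ n) x c → Dec (RepWithin s x c)
repWithin? []      zero    _ = yes ([] , refl , z≤n)
repWithin? []      (suc x) _ = no λ { ([] , () , _) }
repWithin? (g ∷ s) x       c =
  map′ from to (anyUpTo? (λ q → q * g ≤? x ×-dec repWithin? s (x ∸ q * g) (c ∸ q)) (suc c))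
  where
  Head : ℕ → Set
  Head q = q < suc c × q * g ≤ x × RepWithin s (x ∸ q * g) (c ∸ q)
  from : ∃ Head → RepWithin (g ∷ s) x c
  from (q , s≤s q≤c , qg≤x , a , a·s , cost≤) =
    q ∷ a , trans (cong (q * g +_) a·s) (m+[n∸m]≡n qg≤x) ,
    subst (_≤ c) (+-comm (sum a) q) (m≤o∸n⇒m+n≤o (sum a) q≤c cost≤)
  to : RepWithin (g ∷ s) x c → ∃ Head
  to (q ∷ a , e , cost≤) =
    q , s≤s (m+n≤o⇒m≤o q cost≤) , subst (q * g ≤_) e (m≤m+n (q * g) (a · s)) ,
    a , trans (sym (m+n∸m≡n (q * g) (a · s))) (cong (_∸ q * g) e) ,
    m+n≤o⇒m≤o∸n (sum a) (subst (_≤ c) (+-comm q (sum a)) cost≤)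

InSG? : ∀ (s : Vec ℕ n) → (∀ {g} → g ∈ s → 0 < g) → Decidable (InSG s)
InSG? s pos x = map′ (λ (a , a·s , _) → a , a·s)
                     (λ (a , a·s) → a , a·s , subst (sum a ≤_) a·s (cost≤value s a pos))
                     (repWithin? s x x)

least : {P : ℕ → Set} → Decidable P → ∀ {n} → P n →
        ∃ λ m → P m × (∀ {j} → j < m → ¬ P j)
least {P} P? {n} = <-rec (λ n → P n → ∃ λ m → P m × (∀ {j} → j < m → ¬ P j)) search n
  where
  search : ∀ n → (∀ {j} → j < n → P j → ∃ λ m → P m × (∀ {i} → i < m → ¬ P i)) →
           P n → ∃ λ m → P m × (∀ {j} → j < m → ¬ P j)
  search n below Pn with anyUpTo? P? n
  ... | yes (j , j<n , Pj) = below j<n Pj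
  ... | no none            = n , Pn , λ j<n Pj → none (_ , j<n , Pj)

minCost : ∀ (s : Vec ℕ n) {x} → InSG s x → ∃ (IsMinCost s x)
minCost s {x} (a₀ , a₀·s) =
  let c , (a , a·s , cost≤c) , minimal = least (repWithin? s x) (a₀ , a₀·s , ≤-refl)
      optimal : ∀ b → b · s ≡ x → c ≤ sum b
      optimal b b·s = ≮⇒≥ λ cost<c → minimal cost<c (b , b·s , ≤-refl)
  in c , (a , a·s , ≤-antisym cost≤c (optimal a a·s)) , optimal

IsMinCost-unique : ∀ {s : Vec ℕ n} {x m m′} → IsMinCost s x m → IsMinCost s x m′ → m ≡ m′
IsMinCost-unique ((a , a·s , refl) , optimal) ((a′ , a′·s , refl) , optimal′) =
  ≤-antisym (optimal a′ a′·s) (optimal′ a a·s)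

module Generators (s : Vec ℕ n) (pos : ∀ {g} → g ∈ s → 0 < g) where

  ∈S? : Decidable (InSG s)
  ∈S? = InSG? s pos

  InSG-addClosed : AddClosed (InSG s) (reverse s)
  InSG-addClosed {g = g} g∈ (a , a·s) =
    let b , b·s , _ = adjoin (∈-reverse⁻ g∈) a in b , trans b·s (cong (_+ g) a·s)

  -- The leftover lies in ⟨S⟩ but no generator can be split off it, so it is 0.
  greedy-represents : ∀ {x bs} → GreedyRun (InSG s) (reverse s) x bs → InSG s x →
                      bs · reverse s ≡ x
  greedy-represents {x} {bs} run x∈S with leftover run in eq | leftover-∈ x∈S run
  ... | zero  | _ = begin
    bs · reverse s                ≡⟨ +-identityʳ (bs · reverse s) ⟨
    bs · reverse s + 0            ≡⟨ cong (bs · reverse s +_) eq ⟨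
    bs · reverse s + leftover run ≡⟨ ·+leftover run ⟩
    x                             ∎
    where open ≡-Reasoning
  ... | suc _ | b , b·s with splits-of-positive s b (subst (0 <_) (sym b·s) (s≤s z≤n))
  ...   | g , g∈s , sp = ⊥-elim (leftover-stuck InSG-addClosed run (∈-reverse⁺ g∈s)
            (subst (g ≤_) b≡ g≤value) (remainder , trans remainder-value (cong (_∸ g) b≡)))
    where
    open Splits sp
    b≡ : b · s ≡ leftover run
    b≡ = trans b·s (sym eq)

  greedy : ∀ {x} → InSG s x → ∃ (GreedyRun (InSG s) (reverse s) x)
  greedy = greedyRun-exists ∈S? (reverse s) (pos ∘ ∈-reverse⁻)

  greedyCost-of-run : ∀ {x bs} → GreedyRun (InSG s) (reverse s) x bs → IsGreedyCost s x (sum bs)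
  greedyCost-of-run {x} {bs} run =
    reverse bs ,
    subst (GreedyRun (InSG s) (reverse s) x) (sym (reverse-involutive bs)) run ,
    sum-reverse bs

  greedy-optimal : ∀ {x bs} → ¬ GreedyFails s x → GreedyRun (InSG s) (reverse s) x bs →
                   ∀ b → b · s ≡ x → sum bs ≤ sum b
  greedy-optimal {zero} {bs} _ run b b·s =
    ≤-trans (subst (sum bs ≤_) (greedy-represents run (b , b·s))
                   (cost≤value (reverse s) bs (pos ∘ ∈-reverse⁻)))
            z≤n
  greedy-optimal {suc x} {bs} not-failure run b b·s =
    let m , mc@(_ , optimal) = minCost s (b , b·s) in
    ≤-trans (≮⇒≥ λ m<g →
               not-failure ((b , b·s) , s≤s z≤n , m , sum bs , mc , greedyCost-of-run run , m<g))
            (optimal b b·s)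

  greedyFails? : Decidable (GreedyFails s)
  greedyFails? zero = no λ { (_ , () , _) }
  greedyFails? x@(suc _) with ∈S? x
  ... | no ∉S = no (∉S ∘ proj₁)
  ... | yes ∈S =
    let m , mc = minCost s ∈S
        bs , run = greedy ∈S
    in map′
    (λ m<g → ∈S , s≤s z≤n , m , sum bs , mc , greedyCost-of-run run , m<g)
    (λ { (_ , _ , m′ , _ , mc′ , (a , run′ , refl) , m′<g) →
         subst₂ _<_ (IsMinCost-unique mc′ mc)
           (trans (sym (sum-reverse a)) (cong sum (GreedyRun-functional run′ run))) m′<g })
    (m <? sum bs)

  leastGreedyFailure? : Decidable (IsLeastGreedyFailure s)
  leastGreedyFailure? k = greedyFails? k ×-dec
    map′ (λ none k′ k′<k → none {k′} k′<k) (λ none {k′} k′<k → none k′ k′<k)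
         (allUpTo? (¬? ∘ greedyFails?) k)

increasing⇒AllPairs : ∀ (s : Vec ℕ n) → (∀ (i j : Fin n) → i Fin.< j → lookup s i < lookup s j) →
                      AllPairs _<_ s
increasing⇒AllPairs []      _   = []
increasing⇒AllPairs (x ∷ s) inc =
  lookup⁻ (λ i → inc Fin.zero (Fin.suc i) (s≤s z≤n)) ∷
  increasing⇒AllPairs s (λ i j i<j → inc (Fin.suc i) (Fin.suc j) (s≤s i<j))

module Valid {n} (s : Vec ℕ (suc (suc (suc n)))) (valid : ValidGens s) where

  private
    increasing : ∀ (i j : Fin (suc (suc (suc n)))) → i Fin.< j → lookup s i < lookup s j
    increasing = proj₁ (proj₂ valid)

  lookup-mono : ∀ {i j} → i Fin.≤ j → lookup s i ≤ lookup s j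
  lookup-mono {i} {j} i≤j with i Finₚ.≟ j
  ... | yes refl = ≤-refl
  ... | no  i≢j  = <⇒≤ (increasing i j (Finₚ.≤∧≢⇒< i≤j i≢j))

  generator>1 : ∀ {g} → g ∈ s → 1 < g
  generator>1 g∈s with ∈⇒lookup g∈s
  ... | i , refl = proj₁ valid i

  s₁≤ : ∀ {g} → g ∈ s → s₁ s ≤ g
  s₁≤ g∈s with ∈⇒lookup g∈s
  ... | i , refl = lookup-mono {Fin.zero} {i} z≤n

  ≤sₜ : ∀ {g} → g ∈ s → g ≤ sₜ s
  ≤sₜ g∈s with ∈⇒lookup g∈s
  ... | i , refl = lookup-mono (≤fromℕ i)

  <next⇒≤ : ∀ j {g} → g ∈ s → g < lookup s (Fin.suc j) → g ≤ lookup s (Fin.inject₁ j)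
  <next⇒≤ j g∈s g<next with ∈⇒lookup g∈s
  ... | i , refl = lookup-mono (subst (toℕ i ≤_) (sym (toℕ-inject₁ j))
                     (≮⇒≥ λ j<i → <⇒≱ g<next (lookup-mono {Fin.suc j} {i} j<i)))

  descending : AllPairs _>_ (reverse s)
  descending = AllPairs-reverse (increasing⇒AllPairs s increasing)

  open Generators s (<⇒≤ ∘ generator>1) public

  firstPick′ : ∀ {r as} → GreedyRun (InSG s) (reverse s) r as → 0 < sum as →
               FirstPick (InSG s) (reverse s) r as
  firstPick′ = firstPick InSG-addClosed descending

  pick-above-Frobenius : ∀ {F r as} → IsFrobenius s F → F + sₜ s < r →
                         (fp : FirstPick (InSG s) (reverse s) r as) → FirstPick.pick fp ≡ sₜ s
  pick-above-Frobenius {F} {r} (_ , above-F) F+t<r fp =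
    ≤-antisym (≤sₜ (∈-reverse⁻ pick∈))
      (≮⇒≥ λ pick<t → skipped (∈-reverse⁺ (∈-lookup _ s)) pick<t
                        (≤-trans (m≤n+m (sₜ s) F) (<⇒≤ F+t<r))
                        (above-F (r ∸ sₜ s) (m+n≤o⇒m≤o∸n (suc F) F+t<r)))
    where open FirstPick fp

  greedy-above-Frobenius : ∀ {F x cs} → IsFrobenius s F → F + sₜ s < x →
                           GreedyRun (InSG s) (reverse s) x cs →
                           ∃ λ e → e · s ≡ x ∸ sₜ s × suc (sum e) ≡ sum cs
  greedy-above-Frobenius {F} {x} {cs} frob@(_ , above-F) F+t<x run =
    reverse rest ,
    trans (·-reverse rest s) (trans (greedy-represents rest-run G-after) (cong (x ∸_) pick≡t)) ,
    trans (cong suc (sum-reverse rest)) rest-cost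
    where
    x∈S : InSG s x
    x∈S = above-F x (≤-<-trans (m≤m+n F (sₜ s)) F+t<x)
    fp : FirstPick (InSG s) (reverse s) x cs
    fp = firstPick′ run (cost-positive (reverse s) cs
           (subst (0 <_) (sym (greedy-represents run x∈S)) (≤-<-trans z≤n F+t<x)))
    open FirstPick fp
    pick≡t : pick ≡ sₜ s
    pick≡t = pick-above-Frobenius frob F+t<x fp

  -- a₀ need not be optimal: it only has to beat greedy.
  module LeastFailure {k} (k>0 : 0 < k) (below : ∀ k′ → k′ < k → ¬ GreedyFails s k′)
                      {a₀} (a₀·s : a₀ · s ≡ k)
                      {gr} (run : GreedyRun (InSG s) (reverse s) k gr) (cheaper : sum a₀ < sum gr) where

    first : FirstPick (InSG s) (reverse s) k gr
    first = firstPick′ run (≤-<-trans z≤n cheaper)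
    open FirstPick first

    pick∈s : pick ∈ s
    pick∈s = ∈-reverse⁻ pick∈

    pick>0 : 0 < pick
    pick>0 = <⇒≤ (generator>1 pick∈s)

    -- Greedy is optimal at k ∸ pick < k and costs one less there than at k.
    a₀-cheaper-than-rest : ∀ c → c · s ≡ k ∸ pick → sum a₀ ≤ sum c
    a₀-cheaper-than-rest c c·s =
      ≤-trans (s≤s⁻¹ (subst (sum a₀ <_) (sym rest-cost) cheaper))
              (greedy-optimal (below _ (∸-monoʳ-< pick>0 pick≤)) rest-run c c·s)

    module _ {g} (sp : Splits s a₀ g) where
      open Splits sp

      remainder≡k∸g : remainder · s ≡ k ∸ g
      remainder≡k∸g = trans remainder-value (cong (_∸ g) a₀·s)

      g≤k : g ≤ k
      g≤k = subst (g ≤_) a₀·s g≤value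

      below-remainder⇒cheaper : ∀ (c : Vec ℕ (suc (suc (suc n)))) →
                                sum c ≤ sum remainder → sum c < sum a₀
      below-remainder⇒cheaper _ c≤ = ≤-<-trans c≤ (subst (sum remainder <_) remainder-cost ≤-refl)

    splits-below-pick : ∀ {g} → g ∈ s → Splits s a₀ g → g < pick
    splits-below-pick {g} g∈s sp with <-cmp g pick
    ... | tri< g<pick _ _ = g<pick
    ... | tri≈ _ refl _   = ⊥-elim (<⇒≱ (below-remainder⇒cheaper sp remainder ≤-refl)
                                        (a₀-cheaper-than-rest remainder (remainder≡k∸g sp)))
      where open Splits sp
    ... | tri> _ _ pick<g =
      ⊥-elim (skipped (∈-reverse⁺ g∈s) pick<g (g≤k sp) (remainder , remainder≡k∸g sp))
      where open Splits sp

    k≤cost*bound : ∀ {c} → (∀ {g} → g ∈ s → g < pick → g ≤ c) → k ≤ sum a₀ * c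
    k≤cost*bound bound =
      subst (_≤ _) a₀·s (value≤cost*max s a₀ λ g∈s sp → bound g∈s (splits-below-pick g∈s sp))

    cost*s₁≤k∸pick : sum a₀ * s₁ s ≤ k ∸ pick
    cost*s₁≤k∸pick = let c , c·s = G-after in begin
      sum a₀ * s₁ s  ≤⟨ *-monoˡ-≤ (s₁ s) (a₀-cheaper-than-rest c c·s) ⟩
      sum c * s₁ s   ≤⟨ cost*min≤value s c s₁≤ ⟩
      c · s          ≡⟨ c·s ⟩
      k ∸ pick       ∎
      where open ≤-Reasoning

    lower-bound : s₃ s + s₁ s + 2 ≤ k
    lower-bound with s₃ s ≤? pick | 2 ≤? sum a₀
    ... | no pick≱s₃ | _ =
      ⊥-elim (<⇒≱ (∸-monoʳ-< pick>0 pick≤) (≤-trans (k≤cost*bound below-s₂) cost*s₁≤k∸pick))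
      where
      pick≤s₂ : pick ≤ lookup s (Fin.suc Fin.zero)
      pick≤s₂ = <next⇒≤ (Fin.suc Fin.zero) pick∈s (≰⇒> pick≱s₃)
      below-s₂ : ∀ {g} → g ∈ s → g < pick → g ≤ s₁ s
      below-s₂ g∈s g<pick = <next⇒≤ Fin.zero g∈s (<-≤-trans g<pick pick≤s₂)
    ... | yes _ | no cost≱2 = ⊥-elim (<⇒≱ (<-≤-trans (pred<self pick>0) pick≤) (begin
      k                    ≤⟨ k≤cost*bound (λ _ → <⇒≤pred) ⟩
      sum a₀ * pred pick   ≤⟨ *-monoˡ-≤ (pred pick) (s≤s⁻¹ (≰⇒> cost≱2)) ⟩
      1 * pred pick        ≡⟨ *-identityˡ (pred pick) ⟩
      pred pick            ∎))
      where open ≤-Reasoning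
    ... | yes s₃≤pick | yes cost≥2 = begin
      s₃ s + s₁ s + 2       ≡⟨ +-assoc (s₃ s) (s₁ s) 2 ⟩
      s₃ s + (s₁ s + 2)     ≤⟨ +-mono-≤ s₃≤pick (+-monoʳ-≤ (s₁ s) (proj₁ valid Fin.zero)) ⟩
      pick + (s₁ s + s₁ s)  ≡⟨ cong (λ z → pick + (s₁ s + z)) (+-identityʳ (s₁ s)) ⟨
      pick + 2 * s₁ s       ≤⟨ +-monoʳ-≤ pick (*-monoˡ-≤ (s₁ s) cost≥2) ⟩
      pick + sum a₀ * s₁ s  ≤⟨ +-monoʳ-≤ pick cost*s₁≤k∸pick ⟩
      pick + (k ∸ pick)     ≡⟨ m+[n∸m]≡n pick≤ ⟩
      k                     ∎
      where open ≤-Reasoning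

    module _ {F} (frob : IsFrobenius s F) (beyond : F + sₜ s + sₜ₋₁ s < k) where

      F+t<k : F + sₜ s < k
      F+t<k = ≤-<-trans (m≤m+n (F + sₜ s) (sₜ₋₁ s)) beyond

      a₀-cheaper-than-k∸t : ∀ c → c · s ≡ k ∸ sₜ s → sum a₀ ≤ sum c
      a₀-cheaper-than-k∸t = subst (λ L → ∀ c → c · s ≡ k ∸ L → sum a₀ ≤ sum c)
                                  (pick-above-Frobenius frob F+t<k first) a₀-cheaper-than-rest

      -- Greedy at k ∸ g starts with sₜ; trading that sₜ for g represents k ∸ sₜ.
      cheap-rep-of-k∸t : ∀ {g} → g ∈ s → g < sₜ s → (sp : Splits s a₀ g) →
                         ∃ λ e → e · s ≡ k ∸ sₜ s × sum e ≤ sum (Splits.remainder sp)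
      cheap-rep-of-k∸t {g} g∈s g<t sp =
        let cs , run-x = greedy (remainder , remainder≡k∸g sp)
            e , e·s , cost-e = greedy-above-Frobenius frob F+t<x run-x
            e′ , e′·s , cost-e′ = adjoin g∈s e
        in e′ ,
           (begin-equality
             e′ · s            ≡⟨ e′·s ⟩
             e · s + g         ≡⟨ cong (_+ g) e·s ⟩
             k ∸ g ∸ sₜ s + g  ≡⟨ m∸n∸o+n≡m∸o (g≤k sp) (≤-trans (m≤n+m (sₜ s) F) (<⇒≤ F+t<x)) ⟩
             k ∸ sₜ s          ∎) ,
           (begin
             sum e′            ≡⟨ cost-e′ ⟩
             suc (sum e)       ≡⟨ cost-e ⟩
             sum cs            ≤⟨ greedy-optimal (below _ (∸-monoʳ-< (<⇒≤ (generator>1 g∈s)) (g≤k sp)))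
                                     run-x remainder (remainder≡k∸g sp) ⟩
             sum remainder     ∎)
        where
        open Splits sp
        open ≤-Reasoning
        F+t<x : F + sₜ s < k ∸ g
        F+t<x = m+n≤o⇒m≤o∸n (suc (F + sₜ s))
                  (≤-<-trans (+-monoʳ-≤ (F + sₜ s) (<next⇒≤ (Fin.fromℕ (suc n)) g∈s g<t)) beyond)

      no-split : ∀ {g} → g ∈ s → ¬ Splits s a₀ g
      no-split {g} g∈s sp with m≤n⇒m<n∨m≡n (≤sₜ g∈s)
      ... | inj₂ refl = <⇒≱ (below-remainder⇒cheaper sp remainder ≤-refl)
                            (a₀-cheaper-than-k∸t remainder (remainder≡k∸g sp))
        where open Splits sp
      ... | inj₁ g<t  = let e , e·s , e≤ = cheap-rep-of-k∸t g∈s g<t sp in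
                        <⇒≱ (below-remainder⇒cheaper sp e e≤) (a₀-cheaper-than-k∸t e e·s)

    upper-bound : ∀ {F} → IsFrobenius s F → k ≤ F + sₜ s + sₜ₋₁ s
    upper-bound frob = ≮⇒≥ λ beyond →
      let _ , g∈s , sp = splits-of-positive s a₀ (subst (0 <_) (sym a₀·s) k>0) in
      no-split frob beyond g∈s sp

  least-failure-bounds : ∀ {F k} → IsFrobenius s F → IsLeastGreedyFailure s k →
                         s₃ s + s₁ s + 2 ≤ k × k ≤ F + sₜ s + sₜ₋₁ s
  least-failure-bounds frob
    ((_ , k>0 , _ , _ , ((a₀ , a₀·s , refl) , _) , (a , run , refl) , m<g) , below) =
    lower-bound , upper-bound frob
    where open LeastFailure k>0 below {a₀} a₀·s run (subst (_ <_) (sym (sum-reverse a)) m<g)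

validGens? : ∀ (s : Vec ℕ t) → Dec (ValidGens s)
validGens? s = all? (λ i → 1 <? lookup s i)
         ×-dec all? (λ i → all? λ j → i Finₚ.<? j →-dec lookup s i <? lookup s j)
         ×-dec foldr (λ _ → ℕ) gcd 0 s ≟ 1

InSG-2-5-above-3 : ∀ x m → InSG (2 ∷ 5 ∷ x ∷ []) (4 + m)
InSG-2-5-above-3 x zero          = 2 ∷ 0 ∷ 0 ∷ [] , refl
InSG-2-5-above-3 x (suc zero)    = 0 ∷ 1 ∷ 0 ∷ [] , refl
InSG-2-5-above-3 x (suc (suc m)) =
  let a , a·s = InSG-2-5-above-3 x m
      b , b·s , _ = adjoin (here refl) a
  in b , trans b·s (trans (cong (_+ 2) a·s) (+-comm (4 + m) 2))

frobenius-2-5 : ∀ x → ¬ InSG (2 ∷ 5 ∷ x ∷ []) 3 → IsFrobenius (2 ∷ 5 ∷ x ∷ []) 3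
frobenius-2-5 x 3∉S =
  3∉S , λ m 3<m → subst (InSG _) (m+[n∸m]≡n 3<m) (InSG-2-5-above-3 x (m ∸ 4))

lower-bound-attained : ∃ λ n → Σ (Vec ℕ (suc (suc (suc n)))) λ s → ∃ λ F → ∃ λ k →
  ValidGens s × IsFrobenius s F × IsLeastGreedyFailure s k × k ≡ s₃ s + s₁ s + 2
lower-bound-attained =
  0 , s , 3 , 10 , valid , frobenius-2-5 6 (toWitnessFalse {a? = ∈S? 3} tt) ,
  toWitness {a? = leastGreedyFailure? 10} tt , refl
  where
  s : Vec ℕ 3
  s = 2 ∷ 5 ∷ 6 ∷ []
  valid : ValidGens s
  valid = toWitness {a? = validGens? s} tt
  open Valid s valid

upper-bound-attained : ∃ λ n → Σ (Vec ℕ (suc (suc (suc n)))) λ s → ∃ λ F → ∃ λ k →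
  ValidGens s × IsFrobenius s F × IsLeastGreedyFailure s k × k ≡ F + sₜ s + sₜ₋₁ s
upper-bound-attained =
  0 , s , 3 , 15 , valid , frobenius-2-5 7 (toWitnessFalse {a? = ∈S? 3} tt) ,
  toWitness {a? = leastGreedyFailure? 15} tt , refl
  where
  s : Vec ℕ 3
  s = 2 ∷ 5 ∷ 7 ∷ []
  valid : ValidGens s
  valid = toWitness {a? = validGens? s} tt
  open Valid s valid

theorem1 :
    ((n : ℕ) (s : Vec ℕ (suc (suc (suc n)))) → ValidGens s →
       (F : ℕ) → IsFrobenius s F → (k : ℕ) → IsLeastGreedyFailure s k →
       (s₃ s + s₁ s + 2 ≤ k) × (k ≤ F + sₜ s + sₜ₋₁ s))
    × (∃ λ n → Σ (Vec ℕ (suc (suc (suc n)))) λ s → ∃ λ F → ∃ λ k →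
         ValidGens s × IsFrobenius s F × IsLeastGreedyFailure s k × k ≡ s₃ s + s₁ s + 2)
    × (∃ λ n → Σ (Vec ℕ (suc (suc (suc n)))) λ s → ∃ λ F → ∃ λ k →
         ValidGens s × IsFrobenius s F × IsLeastGreedyFailure s k × k ≡ F + sₜ s + sₜ₋₁ s)
theorem1 =
  (λ _ s valid _ frob _ least → Valid.least-failure-bounds s valid frob least) ,
  lower-bound-attained ,
  upper-bound-attained
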